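{- Let $G$ be a finite connected bipartite graph with bipartition $(E,O)$, and let $H=(H_1,\dots,H_n)$ be a hunter strategy that respects parity (i.e. $H_t\subseteq O$ for odd $t$ and $H_t\subseteq E$ for even $t$) and wins when the rabbit starts on an odd vertex, i.e. with $R(0)=O$ and $R(t)=N(R(t-1)\setminus H_t)$ one has $R(t)=\emptyset$ for some $t$. Then $H$ can be extended to a hunter strategy $H\cdot H'$ (with $H$ as initial part) that is winning for every starting position of the rabbit, i.e. starting from $R(0)=V(G)$, and in which no time step uses more than $\max_t|H_t|$ shots.
   Context: A hunter strategy is a finite sequence of multisets of vertices; $N(S)$ denotes the set of vertices adjacent to some vertex of $S$; $H\cdot H'$ denotes concatenation of sequences. A strategy $K=(K_1,\dots,K_m)$ is winning (for every starting position) if, setting $R(0)=V(G)$ and $R(t)=N(R(t-1)\setminus K_t)$, some $R(t)=\emptyset$. -}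

module Defs where

open import Data.Bool using (Bool; true; false; _∧_; not)
open import Data.Nat using (ℕ; zero; suc; _⊔_; _≤_)
open import Data.Fin using (Fin; _≟_)
open import Data.Bool.ListAction using (any)
open import Data.List using (List; []; _∷_; length; foldr; take; lookup; allFin)
open import Data.List.Relation.Unary.All using (All)
open import Data.Product using (Σ; _×_; ∃-syntax)
open import Relation.Binary.PropositionalEquality using (_≡_; _≢_)
open import Relation.Nullary.Decidable using (⌊_⌋)
import Data.Fin as F

record Graph (k : ℕ) : Set where
  field
    adj     : Fin k → Fin k → Bool
    symm    : ∀ u v → adj u v ≡ adj v u
    irrefl  : ∀ v → adj v v ≡ false

open Graph public

data Walk {k : ℕ} (G : Graph k) : Fin k → Fin k → Set where
  here : ∀ {v} → Walk G v v
  step : ∀ {u v w} → adj G u v ≡ true → Walk G v w → Walk G u w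

Connected : ∀ {k} → Graph k → Set
Connected G = ∀ u v → Walk G u v

-- (E , O) given by odd : V → Bool (O = odd⁻¹ true, E = odd⁻¹ false)
-- is a bipartition of G: every edge joins E and O.
IsBipartition : ∀ {k} → Graph k → (Fin k → Bool) → Set
IsBipartition G odd = ∀ u v → adj G u v ≡ true → odd u ≢ odd v

VSet : ℕ → Set
VSet k = Fin k → Bool

Empty : ∀ {k} → VSet k → Set
Empty R = ∀ v → R v ≡ false

N : ∀ {k} → Graph k → VSet k → VSet k
N G S v = any (λ u → S u ∧ adj G u v) (allFin _)

-- A multiset of vertices (a round of shots) is a list of vertices;
-- a hunter strategy is a list of rounds.
Shots : ℕ → Set
Shots k = List (Fin k)

Strategy : ℕ → Set
Strategy k = List (Shots k)

_∖_ : ∀ {k} → VSet k → Shots k → VSet k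
(R ∖ K) v = R v ∧ not (any (λ u → ⌊ u ≟ v ⌋) K)

run : ∀ {k} → Graph k → VSet k → Strategy k → VSet k
run G R []       = R
run G R (K ∷ H)  = run G (N G (R ∖ K)) H

-- R(t) = run G R0 (take t H); H wins from R0 if some R(t), t ≤ |H|, is empty.
Wins : ∀ {k} → Graph k → VSet k → Strategy k → Set
Wins G R0 H = ∃[ t ] (t ≤ length H × Empty (run G R0 (take t H)))

oddℕ : ℕ → Bool
oddℕ zero = false
oddℕ (suc n) = not (oddℕ n)

-- H_t ⊆ O for odd t, H_t ⊆ E for even t (t = 1,…,n, 1-indexed).
RespectsParity : ∀ {k} → (Fin k → Bool) → Strategy k → Set
RespectsParity odd H =
  ∀ (i : Fin (length H)) → All (λ v → odd v ≡ oddℕ (suc (F.toℕ i))) (lookup H i)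

maxShots : ∀ {k} → Strategy k → ℕ
maxShots H = foldr (λ K m → length K ⊔ m) 0 H

allV : ∀ {k} → VSet k
allV _ = true

-- Split the rabbit's starting set V(G) into the odd and the even vertices.
-- Rabbits starting on O are caught by H by hypothesis.  Along any edge the
-- parity of a vertex changes, so the possible positions of a rabbit starting
-- on E all lie on one side of the bipartition at every time, whatever is shot.
-- After H they therefore lie on a known side: if it is O, playing H again
-- catches them; if it is E, one idle round moves them to O and then H does.
-- The extension consists of rounds of H and possibly an empty round, so it
-- never shoots more than max_t |H_t|.
module Submission where

open import Defs
open import Data.Bool using (Bool; true; false; _∧_; _∨_; not)
open import Data.Bool.Properties using (T-≡; ¬-not; not-injective; ∧-conicalˡ; ∧-conicalʳ; ∧-distribʳ-∨)
open import Data.Nat using (ℕ; _≤_; z≤n)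
open import Data.Nat.Properties using (≤-refl; m≤m⊔n; m≤n⇒m≤o⊔n)
open import Data.Fin using (Fin)
open import Data.List using (List; []; _∷_; length; _++_; take; drop; allFin)
open import Data.List.Properties using (take-all; take++drop≡id)
open import Data.List.Relation.Unary.All as All using (All; []; _∷_)
open import Data.List.Relation.Unary.Any using (satisfied)
open import Data.List.Relation.Unary.Any.Properties using (any⁺; any⁻)
open import Data.List.Membership.Propositional using (lose)
open import Data.List.Membership.Propositional.Properties using (∈-allFin)
open import Data.Product using (_×_; ∃-syntax; _,_)
open import Data.Sum as Sum using (_⊎_; inj₁; inj₂)
open import Function using (_∘_; case_of_; Equivalence)
open import Relation.Binary.PropositionalEquality using (_≡_; refl; sym; trans; cong₂; subst)

private
  variable
    k : ℕ

open Equivalence using (to; from)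

∨-true⁻ : ∀ {x y} → x ∨ y ≡ true → x ≡ true ⊎ y ≡ true
∨-true⁻ {true}  _ = inj₁ refl
∨-true⁻ {false} y = inj₂ y

∨-true⁺ : ∀ {x y} → x ≡ true ⊎ y ≡ true → x ∨ y ≡ true
∨-true⁺ {true}  _        = refl
∨-true⁺ {false} (inj₂ y) = y

infix 4 _⊆_
infixr 6 _∪_

_⊆_ : VSet k → VSet k → Set
R ⊆ S = ∀ v → R v ≡ true → S v ≡ true

_∪_ : VSet k → VSet k → VSet k
(R ∪ S) v = R v ∨ S v

∅ : VSet k
∅ _ = false

OnSide : (Fin k → Bool) → Bool → VSet k → Set
OnSide odd c R = ∀ v → R v ≡ true → odd v ≡ c

⊆∅⇒Empty : {R : VSet k} → R ⊆ ∅ → Empty R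
⊆∅⇒Empty R⊆∅ v = ¬-not (λ v∈R → case R⊆∅ v v∈R of λ ())

Empty⇒⊆∅ : {R : VSet k} → Empty R → R ⊆ ∅
Empty⇒⊆∅ empty v = trans (sym (empty v))

OnSide-⊆ : ∀ {odd : Fin k → Bool} {c R S} → R ⊆ S → OnSide odd c S → OnSide odd c R
OnSide-⊆ R⊆S S-on-c v v∈R = S-on-c v (R⊆S v v∈R)

∈N⁻ : ∀ (G : Graph k) S v → N G S v ≡ true → ∃[ u ] (S u ≡ true × adj G u v ≡ true)
∈N⁻ G S v v∈NS with satisfied (any⁻ (λ u → S u ∧ adj G u v) (allFin _) (from T-≡ v∈NS))
... | u , edge-from-S = u , ∧-conicalˡ _ _ Su∧uv , ∧-conicalʳ _ _ Su∧uv
  where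
  Su∧uv : S u ∧ adj G u v ≡ true
  Su∧uv = to T-≡ edge-from-S

∈N⁺ : ∀ (G : Graph k) S {u v} → S u ≡ true → adj G u v ≡ true → N G S v ≡ true
∈N⁺ G S {u} {v} u∈S uv =
  to T-≡ (any⁺ (λ w → S w ∧ adj G w v) (lose (∈-allFin u) (from T-≡ (cong₂ _∧_ u∈S uv))))

N-mono : ∀ (G : Graph k) {R S} → R ⊆ S → N G R ⊆ N G S
N-mono G {R} {S} R⊆S v v∈NR with ∈N⁻ G R v v∈NR
... | u , u∈R , uv = ∈N⁺ G S (R⊆S u u∈R) uv

N-∪ : ∀ (G : Graph k) {R S} → N G (R ∪ S) ⊆ N G R ∪ N G S
N-∪ G {R} {S} v v∈N[R∪S] with ∈N⁻ G (R ∪ S) v v∈N[R∪S]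
... | u , u∈R∪S , uv =
  ∨-true⁺ (Sum.map (λ u∈R → ∈N⁺ G R u∈R uv) (λ u∈S → ∈N⁺ G S u∈S uv) (∨-true⁻ u∈R∪S))

N-∅ : ∀ (G : Graph k) → N G ∅ ⊆ ∅
N-∅ G v v∈N∅ with ∈N⁻ G ∅ v v∈N∅
... | _ , () , _

N-OnSide : ∀ (G : Graph k) {odd} → IsBipartition G odd →
           ∀ {c R} → OnSide odd c R → OnSide odd (not c) (N G R)
N-OnSide G bip {R = R} R-on-c v v∈NR with ∈N⁻ G R v v∈NR
... | u , u∈R , uv with R-on-c u u∈R
... | refl = ¬-not (λ same → bip u v uv (sym same))

∖-⊆ : ∀ (R : VSet k) K → R ∖ K ⊆ R
∖-⊆ R K v = ∧-conicalˡ (R v) _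

∖-mono : ∀ {R S : VSet k} K → R ⊆ S → R ∖ K ⊆ S ∖ K
∖-mono {R = R} K R⊆S v v∈R∖K =
  cong₂ _∧_ (R⊆S v (∧-conicalˡ (R v) _ v∈R∖K)) (∧-conicalʳ (R v) _ v∈R∖K)

∖-∪ : ∀ (R S : VSet k) K → (R ∪ S) ∖ K ⊆ (R ∖ K) ∪ (S ∖ K)
∖-∪ R S K v = trans (sym (∧-distribʳ-∨ _ (R v) (S v)))

run-++ : ∀ (G : Graph k) R (H H' : Strategy k) → run G R (H ++ H') ≡ run G (run G R H) H'
run-++ G R []      H' = refl
run-++ G R (K ∷ H) H' = run-++ G (N G (R ∖ K)) H H'

run-mono : ∀ (G : Graph k) (H : Strategy k) {R S} → R ⊆ S → run G R H ⊆ run G S H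
run-mono G []      R⊆S = R⊆S
run-mono G (K ∷ H) R⊆S = run-mono G H (N-mono G (∖-mono K R⊆S))

run-∪ : ∀ (G : Graph k) (H : Strategy k) {R S} → run G (R ∪ S) H ⊆ run G R H ∪ run G S H
run-∪ G []      v v∈R∪S = v∈R∪S
run-∪ G (K ∷ H) {R} {S} v v∈run =
  run-∪ G H v (run-mono G H (λ u u∈N → N-∪ G u (N-mono G (∖-∪ R S K) u u∈N)) v v∈run)

run-∅ : ∀ (G : Graph k) (H : Strategy k) → run G ∅ H ⊆ ∅
run-∅ G []      v ()
run-∅ G (K ∷ H) v v∈run = run-∅ G H v (run-mono G H (N-∅ G) v v∈run)

run-Empty : ∀ (G : Graph k) (H : Strategy k) {R} → Empty R → Empty (run G R H)
run-Empty G H empty =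
  ⊆∅⇒Empty (λ v v∈run → run-∅ G H v (run-mono G H (Empty⇒⊆∅ empty) v v∈run))

sideAfter : ∀ {A : Set} → Bool → List A → Bool
sideAfter c []      = c
sideAfter c (_ ∷ H) = sideAfter (not c) H

run-OnSide : ∀ (G : Graph k) {odd} → IsBipartition G odd → (H : Strategy k) →
             ∀ {c R} → OnSide odd c R → OnSide odd (sideAfter c H) (run G R H)
run-OnSide G bip []      R-on-c = R-on-c
run-OnSide G bip (K ∷ H) {R = R} R-on-c =
  run-OnSide G bip H (N-OnSide G bip (OnSide-⊆ (∖-⊆ R K) R-on-c))

Wins⇒Empty-run : ∀ (G : Graph k) {R} (H : Strategy k) → Wins G R H → Empty (run G R H)
Wins⇒Empty-run G {R} H (t , _ , empty) =
  subst (Empty ∘ run G R) (take++drop≡id t H)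
    (subst Empty (sym (run-++ G R (take t H) (drop t H))) (run-Empty G (drop t H) empty))

Empty-run⇒Wins : ∀ (G : Graph k) {R} (H : Strategy k) → Empty (run G R H) → Wins G R H
Empty-run⇒Wins G {R} H empty =
  length H , ≤-refl , subst (Empty ∘ run G R) (sym (take-all (length H) H ≤-refl)) empty

length≤maxShots : (H : Strategy k) → All (λ K → length K ≤ maxShots H) H
length≤maxShots []      = []
length≤maxShots (K ∷ H) =
  m≤m⊔n (length K) (maxShots H) ∷ All.map (m≤n⇒m≤o⊔n (length K)) (length≤maxShots H)

-- On side E one idle round is needed first, moving the set to side O.
clear-OnSide : ∀ (G : Graph k) {odd} → IsBipartition G odd → (H : Strategy k) →
               Empty (run G odd H) → ∀ c {R} → OnSide odd c R →
               ∃[ H' ] (Empty (run G R H') × All (λ K → length K ≤ maxShots H) H')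
clear-OnSide G bip H oddCleared true R-on-O =
  H , ⊆∅⇒Empty (λ v v∈run → Empty⇒⊆∅ oddCleared v (run-mono G H R-on-O v v∈run))
    , length≤maxShots H
clear-OnSide G bip H oddCleared false {R} R-on-E
  with clear-OnSide G bip H oddCleared true (N-OnSide G bip (OnSide-⊆ (∖-⊆ R []) R-on-E))
... | H' , cleared , bounded = [] ∷ H' , cleared , z≤n ∷ bounded

lemma3p1 : ∀ {k} (G : Graph k) (odd : Fin k → Bool) → Connected G → IsBipartition G odd →
    (H : Strategy k) → RespectsParity odd H → Wins G odd H →
    ∃[ H' ] (Wins G allV (H ++ H') × All (λ K → length K ≤ maxShots H) H')
lemma3p1 G odd _ bip H _ wins
  with clear-OnSide G bip H oddCleared (sideAfter false H) survivorsOnSide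
  where
  oddCleared : Empty (run G odd H)
  oddCleared = Wins⇒Empty-run G H wins

  allV⊆E∪O : allV ⊆ (not ∘ odd) ∪ odd
  allV⊆E∪O v _ with odd v
  ... | true  = refl
  ... | false = refl

  survivorsOnSide : OnSide odd (sideAfter false H) (run G allV H)
  survivorsOnSide v v∈run with ∨-true⁻ (run-∪ G H v (run-mono G H allV⊆E∪O v v∈run))
  ... | inj₁ fromE = run-OnSide G bip H (λ u → not-injective) v fromE
  ... | inj₂ fromO = case Empty⇒⊆∅ oddCleared v fromO of λ ()
... | H' , cleared , bounded =
  H' , Empty-run⇒Wins G (H ++ H') (subst Empty (sym (run-++ G allV H H')) cleared) , bounded
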